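{- For finite simple graphs $G_1,G_2,\ldots,G_\ell$ ($\ell\geq 1$), $\operatorname{im}(G_1\,\Box\, G_2\,\Box\,\cdots\,\Box\, G_\ell)\geq \sum_{i=1}^{\ell}\operatorname{im}(G_i)-(\ell-1)$. Moreover, if $\Delta(G_i)=\operatorname{im}(G_i)-1$ for each $i$, then equality holds: $\operatorname{im}(G_1\,\Box\,\cdots\,\Box\, G_\ell)=\sum_{i=1}^{\ell}\operatorname{im}(G_i)-(\ell-1)$.
   Context: All graphs are finite and simple; $\Delta(\cdot)$ denotes maximum degree. A graph $G$ has a $G'$-immersion if there is an injective map $\phi:V(G')\to V(G)$ such that for every edge $uv\in E(G')$ there is a path in $G$ joining $\phi(u)$ and $\phi(v)$, and these paths are pairwise edge-disjoint. The immersion number $\operatorname{im}(G)$ is the largest $t$ such that $G$ has a $K_t$-immersion. The Cartesian product $G\,\Box\, H$ has vertex set $V(G)\times V(H)$, with $(g,h)$ adjacent to $(g',h')$ iff $g=g'$ and $hh'\in E(H)$, or $gg'\in E(G)$ and $h=h'$. -}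

module Defs where

open import Data.Nat using (ℕ; zero; suc; _+_; _*_; _⊔_; _<_)
open import Data.Fin using (Fin; remQuot; toℕ) renaming (_≟_ to _≟ᶠ_; _<_ to _<ᶠ_)
open import Data.Product using (Σ; _×_; _,_; proj₁; proj₂)
open import Data.Sum using (_⊎_; inj₁; inj₂)
open import Data.List using (List; []; _∷_)
open import Data.List.Membership.Propositional using (_∈_)
open import Data.List.Relation.Unary.Unique.Propositional using (Unique)
open import Data.Vec using (Vec; foldr; count; allFin; map) renaming ([] to []ᵥ; _∷_ to _∷ᵥ_)
open import Relation.Binary.PropositionalEquality using (_≡_; _≢_)
open import Relation.Nullary using (¬_; Dec; yes; no)
open import Relation.Nullary.Decidable using (_×-dec_; _⊎-dec_)
open import Function.Definitions using (Injective)
open import Level using () renaming (suc to lsuc; zero to lzero)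

record Graph : Set₁ where
  field
    n    : ℕ
    Adj  : Fin n → Fin n → Set
    adj? : (u v : Fin n) → Dec (Adj u v)
    sym  : ∀ {u v} → Adj u v → Adj v u
    irr  : ∀ {u} → ¬ Adj u u
open Graph public

-- Cartesian product G □ H on Fin (|G| * |H|), a vertex x being identified
-- with the pair remQuot x : Fin |G| × Fin |H|.
_□_ : Graph → Graph → Graph
G □ H = record
  { n    = n G * n H
  ; Adj  = A
  ; adj? = d
  ; sym  = s
  ; irr  = i
  }
  where
  p : Fin (n G * n H) → Fin (n G) × Fin (n H)
  p = remQuot (n H)
  A : Fin (n G * n H) → Fin (n G * n H) → Set
  A x y = (proj₁ (p x) ≡ proj₁ (p y) × Adj H (proj₂ (p x)) (proj₂ (p y)))
        ⊎ (Adj G (proj₁ (p x)) (proj₁ (p y)) × proj₂ (p x) ≡ proj₂ (p y))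
  d : (x y : Fin (n G * n H)) → Dec (A x y)
  d x y = ((proj₁ (p x) ≟ᶠ proj₁ (p y)) ×-dec adj? H (proj₂ (p x)) (proj₂ (p y)))
          ⊎-dec (adj? G (proj₁ (p x)) (proj₁ (p y)) ×-dec (proj₂ (p x) ≟ᶠ proj₂ (p y)))
  s : ∀ {x y} → A x y → A y x
  s (inj₁ (e , a)) = inj₁ (Relation.Binary.PropositionalEquality.sym e , sym H a)
  s (inj₂ (a , e)) = inj₂ (sym G a , Relation.Binary.PropositionalEquality.sym e)
  i : ∀ {x} → ¬ A x x
  i (inj₁ (_ , a)) = irr H a
  i (inj₂ (a , _)) = irr G a

□-all : ∀ {ℓ} → Vec Graph (suc ℓ) → Graph
□-all (G ∷ᵥ []ᵥ)     = G
□-all (G ∷ᵥ H ∷ᵥ Gs) = G □ □-all (H ∷ᵥ Gs)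

degree : (G : Graph) → Fin (n G) → ℕ
degree G v = count (adj? G v) (allFin (n G))

Δ : Graph → ℕ
Δ G = foldr _ _⊔_ 0 (map (degree G) (allFin (n G)))

data Walk (G : Graph) : Fin (n G) → Fin (n G) → Set where
  []  : ∀ {u} → Walk G u u
  _∷_ : ∀ {u w v} → Adj G u w → Walk G w v → Walk G u v

verts : ∀ {G u v} → Walk G u v → List (Fin (n G))
verts {u = u} []      = u ∷ []
verts {u = u} (_ ∷ w) = u ∷ verts w

edges : ∀ {G u v} → Walk G u v → List (Fin (n G) × Fin (n G))
edges []                    = []
edges {u = u} (_∷_ {w = w} _ p) = (u , w) ∷ edges p

IsPath : ∀ {G u v} → Walk G u v → Set
IsPath p = Unique (verts p)

SameEdge : ∀ {A : Set} → A × A → A × A → Set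
SameEdge (a , b) (c , d) = (a ≡ c × b ≡ d) ⊎ (a ≡ d × b ≡ c)

EdgeDisjoint : ∀ {G u v u' v'} → Walk G u v → Walk G u' v' → Set
EdgeDisjoint p q = ∀ {e e'} → e ∈ edges p → e' ∈ edges q → ¬ SameEdge e e'

HasKImmersion : Graph → ℕ → Set
HasKImmersion G t =
  Σ (Fin t → Fin (n G)) λ φ →
  Injective _≡_ _≡_ φ ×
  Σ ((i j : Fin t) → i <ᶠ j → Walk G (φ i) (φ j)) λ P →
    (∀ i j (h : i <ᶠ j) → IsPath (P i j h)) ×
    (∀ i j i' j' (h : i <ᶠ j) (h' : i' <ᶠ j') →
       ¬ (i ≡ i' × j ≡ j') → EdgeDisjoint (P i j h) (P i' j' h'))

IsImmersionNumber : Graph → ℕ → Set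
IsImmersionNumber G t = HasKImmersion G t × (∀ s → HasKImmersion G s → s Data.Nat.≤ t)

module Submission where

-- K_{a+1}- and K_{b+1}-immersions in G and H give a
-- K_{a+b+1}-immersion in G □ H (immersion-□): the branch vertices of G are
-- copied into one layer, the remaining ones of H into one column, and the
-- connections are copies of the given paths.  The first branch vertex of a K_{t+1}-immersion has t distinct
-- neighbours, so im(G) ≤ Δ(G) + 1; and Δ(G □ H) ≤ Δ(G) + Δ(H) by counting
-- neighbours coordinatewise.

open import Defs
open import Data.Nat using (ℕ; zero; suc; _+_; _∸_; _≤_; _⊔_; z≤n; s≤s; s≤s⁻¹)
open import Data.Nat.Properties
  using (module ≤-Reasoning; ≤-trans; ≤-reflexive; ≤-antisym; m≤m⊔n; m≤n⊔m; ⊔-lub;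
         n≤1+n; m≤m+n; +-mono-≤; +-monoʳ-≤; +-suc; +-comm; +-assoc; +-identityʳ;
         m+n∸n≡m; m∸n+n≡m)
open import Data.Fin using (Fin; zero; suc; fromℕ<; combine; remQuot; splitAt; join)
  renaming (_<_ to _<ᶠ_; _≟_ to _≟ᶠ_)
open import Data.Fin.Properties
  using (suc-injective; 0≢1+n; injective⇒≤; remQuot-combine; combine-remQuot; join-splitAt)
open import Data.Vec using (Vec; []; _∷_; lookup; sum; count; allFin; foldr; map)
open import Data.Vec.Properties using (lookup-map; lookup-allFin)
open import Data.Product using (Σ; ∃; _×_; _,_; proj₁; proj₂; swap)
open import Data.Product.Properties using (,-injective)
open import Data.Sum using (_⊎_; inj₁; inj₂)
open import Data.Sum.Relation.Binary.LeftOrder using (_⊎-<_; ₁∼₂; ₁∼₁; ₂∼₂)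
open import Data.Empty using (⊥-elim)
open import Data.List.Relation.Unary.Any using (here; there)
open import Data.List.Relation.Unary.All using ([])
open import Data.List.Relation.Unary.All.Properties using (¬Any⇒All¬)
open import Data.List.Relation.Unary.AllPairs using ([]; _∷_)
open import Data.List.Membership.Propositional using (_∈_)
open import Data.List.Membership.DecPropositional using () renaming (_∈?_ to member?)
open import Function using (_∘_; _∋_)
open import Function.Definitions using (Injective)
open import Relation.Nullary using (¬_; yes; no)
open import Relation.Nullary.Decidable using (_×-dec_; _⊎-dec_)
open import Relation.Unary using (Decidable)
open import Relation.Binary.PropositionalEquality
  using (_≡_; _≢_; refl; cong; cong₂; trans; subst; subst₂; module ≡-Reasoning)
  renaming (sym to ≡-sym)

private
  variable
    A : Set
    k m t : ℕ

SameEdge-sym : {e e' : A × A} → SameEdge e e' → SameEdge e' e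
SameEdge-sym {e = _ , _} {_ , _} (inj₁ (p , q)) = inj₁ (≡-sym p , ≡-sym q)
SameEdge-sym {e = _ , _} {_ , _} (inj₂ (p , q)) = inj₂ (≡-sym q , ≡-sym p)

SameEdge-trans : {e e' e'' : A × A} → SameEdge e e' → SameEdge e' e'' → SameEdge e e''
SameEdge-trans {e = _ , _} {_ , _} {_ , _} (inj₁ (p , q)) (inj₁ (r , s)) = inj₁ (trans p r , trans q s)
SameEdge-trans {e = _ , _} {_ , _} {_ , _} (inj₁ (p , q)) (inj₂ (r , s)) = inj₂ (trans p r , trans q s)
SameEdge-trans {e = _ , _} {_ , _} {_ , _} (inj₂ (p , q)) (inj₁ (r , s)) = inj₂ (trans p s , trans q r)
SameEdge-trans {e = _ , _} {_ , _} {_ , _} (inj₂ (p , q)) (inj₂ (r , s)) = inj₁ (trans p s , trans q r)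

SameEdge-swap : (e : A × A) → SameEdge e (swap e)
SameEdge-swap (_ , _) = inj₂ (refl , refl)

SameEdge-refl : (e : A × A) → SameEdge e e
SameEdge-refl (_ , _) = inj₁ (refl , refl)

module Walks (G : Graph) where

  infixr 5 _++ʷ_
  _++ʷ_ : ∀ {u v w} → Walk G u v → Walk G v w → Walk G u w
  []      ++ʷ q = q
  (a ∷ p) ++ʷ q = a ∷ (p ++ʷ q)

  edges-++ : ∀ {u v w} (p : Walk G u v) (q : Walk G v w) {e} →
             e ∈ edges (p ++ʷ q) → e ∈ edges p ⊎ e ∈ edges q
  edges-++ []      q e∈      = inj₂ e∈
  edges-++ (a ∷ p) q (here eq) = inj₁ (here eq)
  edges-++ (a ∷ p) q (there e∈) with edges-++ p q e∈
  ... | inj₁ e∈p = inj₁ (there e∈p)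
  ... | inj₂ e∈q = inj₂ e∈q

  reverse : ∀ {u v} → Walk G u v → Walk G v u
  reverse []      = []
  reverse (a ∷ p) = reverse p ++ʷ (Graph.sym G a ∷ [])

  edges-reverse : ∀ {u v} (p : Walk G u v) {e} → e ∈ edges (reverse p) → swap e ∈ edges p
  edges-reverse (a ∷ p) e∈ with edges-++ (reverse p) _ e∈
  ... | inj₁ e∈p           = there (edges-reverse p e∈p)
  ... | inj₂ (here refl) = here refl

  edge-adjacent : ∀ {u v} (p : Walk G u v) {e} → e ∈ edges p → Adj G (proj₁ e) (proj₂ e)
  edge-adjacent (a ∷ p) (here refl) = a
  edge-adjacent (a ∷ p) (there e∈)  = edge-adjacent p e∈

  firstStep : ∀ {u v} (w : Walk G u v) → u ≢ v → ∃ λ x → Adj G u x × (u , x) ∈ edges w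
  firstStep []      u≢u = ⊥-elim (u≢u refl)
  firstStep (a ∷ w) _   = _ , a , here refl

  suffixFrom : ∀ {w v} (x : Fin (n G)) (q : Walk G w v) → x ∈ verts q → Walk G x v
  suffixFrom x []      (here refl) = []
  suffixFrom x (a ∷ q) (here refl) = a ∷ q
  suffixFrom x (a ∷ q) (there x∈)  = suffixFrom x q x∈

  suffixFrom-edges : ∀ {w v} (x : Fin (n G)) (q : Walk G w v) (x∈ : x ∈ verts q) {e} →
                     e ∈ edges (suffixFrom x q x∈) → e ∈ edges q
  suffixFrom-edges x []      (here refl) ()
  suffixFrom-edges x (a ∷ q) (here refl) e∈ = e∈
  suffixFrom-edges x (a ∷ q) (there x∈)  e∈ = there (suffixFrom-edges x q x∈ e∈)

  suffixFrom-isPath : ∀ {w v} (x : Fin (n G)) (q : Walk G w v) (x∈ : x ∈ verts q) →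
                      IsPath q → IsPath (suffixFrom x q x∈)
  suffixFrom-isPath x []      (here refl) q-path       = q-path
  suffixFrom-isPath x (a ∷ q) (here refl) q-path       = q-path
  suffixFrom-isPath x (a ∷ q) (there x∈)  (_ ∷ q-path) = suffixFrom-isPath x q x∈ q-path

  record Shortcut {u v} (w : Walk G u v) : Set where
    field
      path        : Walk G u v
      path-isPath : IsPath path
      path-edges  : ∀ {e} → e ∈ edges path → e ∈ edges w
  open Shortcut public

  shortcut : ∀ {u v} (w : Walk G u v) → Shortcut w
  shortcut []      = record { path = [] ; path-isPath = [] ∷ [] ; path-edges = λ () }
  shortcut {u} (a ∷ w) with shortcut w
  ... | s with member? _≟ᶠ_ u (verts (path s))
  ... | yes u∈ = record
    { path        = suffixFrom u (path s) u∈
    ; path-isPath = suffixFrom-isPath u (path s) u∈ (path-isPath s)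
    ; path-edges  = there ∘ path-edges s ∘ suffixFrom-edges u (path s) u∈
    }
  ... | no u∉ = record
    { path        = a ∷ path s
    ; path-isPath = ¬Any⇒All¬ _ u∉ ∷ path-isPath s
    ; path-edges  = λ { (here eq) → here eq ; (there e∈) → there (path-edges s e∈) }
    }

module _ {P : A → Set} (P? : Decidable P) where

  position : (xs : Vec A m) → Fin (count P? xs) → Fin m
  position (x ∷ xs) k with P? x
  position (x ∷ xs) zero    | yes _ = zero
  position (x ∷ xs) (suc k) | yes _ = suc (position xs k)
  position (x ∷ xs) k       | no _  = suc (position xs k)

  position-injective : (xs : Vec A m) → Injective _≡_ _≡_ (position xs)
  position-injective (x ∷ xs) {k} {l} eq with P? x
  position-injective (x ∷ xs) {zero}  {zero}  eq | yes _ = refl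
  position-injective (x ∷ xs) {suc k} {suc l} eq | yes _ =
    cong suc (position-injective xs (suc-injective eq))
  position-injective (x ∷ xs) {k}     {l}     eq | no _  =
    position-injective xs (suc-injective eq)

  position-satisfies : (xs : Vec A m) (k : Fin (count P? xs)) → P (lookup xs (position xs k))
  position-satisfies (x ∷ xs) k with P? x
  position-satisfies (x ∷ xs) zero    | yes px = px
  position-satisfies (x ∷ xs) (suc k) | yes _  = position-satisfies xs k
  position-satisfies (x ∷ xs) k       | no _   = position-satisfies xs k

  position-complete : (xs : Vec A m) (i : Fin m) → P (lookup xs i) →
                      ∃ λ k → position xs k ≡ i
  position-complete (x ∷ xs) i pi with P? x
  position-complete (x ∷ xs) zero    pi | yes _ = zero , refl
  position-complete (x ∷ xs) (suc i) pi | yes _ with position-complete xs i pi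
  ... | k , eq = suc k , cong suc eq
  position-complete (x ∷ xs) zero    pi | no ¬px = ⊥-elim (¬px pi)
  position-complete (x ∷ xs) (suc i) pi | no _ with position-complete xs i pi
  ... | k , eq = k , cong suc eq

  count-≥ : (xs : Vec A m) (f : Fin t → Fin m) → Injective _≡_ _≡_ f →
            (∀ k → P (lookup xs (f k))) → t ≤ count P? xs
  count-≥ xs f f-injective f-satisfies = injective⇒≤ {f = index} index-injective
    where
    index : _ → Fin (count P? xs)
    index k = proj₁ (position-complete xs (f k) (f-satisfies k))
    index-correct : ∀ k → position xs (index k) ≡ f k
    index-correct k = proj₂ (position-complete xs (f k) (f-satisfies k))
    index-injective : Injective _≡_ _≡_ index
    index-injective {k} {l} eq =
      f-injective (trans (≡-sym (index-correct k))
                         (trans (cong (position xs) eq) (index-correct l)))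

  count-⊎ : {Q : A → Set} (Q? : Decidable Q) (xs : Vec A m) →
            count (λ x → P? x ⊎-dec Q? x) xs ≤ count P? xs + count Q? xs
  count-⊎ Q? []       = z≤n
  count-⊎ Q? (x ∷ xs) with P? x | Q? x
  ... | yes _ | yes _ = s≤s (≤-trans (count-⊎ Q? xs) (+-monoʳ-≤ (count P? xs) (n≤1+n _)))
  ... | yes _ | no _  = s≤s (count-⊎ Q? xs)
  ... | no _  | yes _ = ≤-trans (s≤s (count-⊎ Q? xs)) (≤-reflexive (≡-sym (+-suc _ _)))
  ... | no _  | no _  = count-⊎ Q? xs

elements-≥ : {P : Fin m → Set} (P? : Decidable P) (f : Fin t → Fin m) →
             Injective _≡_ _≡_ f → (∀ k → P (f k)) → t ≤ count P? (allFin m)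
elements-≥ {m = m} {P = P} P? f f-injective f-satisfies =
  count-≥ P? (allFin m) f f-injective
    (λ k → subst P (≡-sym (lookup-allFin (f k))) (f-satisfies k))

elements-≤ : {P : Fin m → Set} {Q : Fin k → Set} (P? : Decidable P) (Q? : Decidable Q)
             (f : Fin m → Fin k) → (∀ {i} → P i → Q (f i)) →
             (∀ {i j} → P i → P j → f i ≡ f j → i ≡ j) →
             count P? (allFin m) ≤ count Q? (allFin k)
elements-≤ {m = m} {P = P} P? Q? f f-preserves f-injective =
  elements-≥ Q? (f ∘ p) p-injective (f-preserves ∘ p-satisfies)
  where
  p : Fin (count P? (allFin m)) → Fin m
  p = position P? (allFin m)
  p-satisfies : ∀ l → P (p l)
  p-satisfies l = subst P (lookup-allFin (p l)) (position-satisfies P? (allFin m) l)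
  p-injective : Injective _≡_ _≡_ (f ∘ p)
  p-injective {l} {l'} eq =
    position-injective P? (allFin m) (f-injective (p-satisfies l) (p-satisfies l') eq)

foldr-⊔-upper : (xs : Vec ℕ k) (i : Fin k) → lookup xs i ≤ foldr _ _⊔_ 0 xs
foldr-⊔-upper (x ∷ xs) zero    = m≤m⊔n x _
foldr-⊔-upper (x ∷ xs) (suc i) = ≤-trans (foldr-⊔-upper xs i) (m≤n⊔m x _)

foldr-⊔-least : (xs : Vec ℕ k) {b : ℕ} → (∀ i → lookup xs i ≤ b) → foldr _ _⊔_ 0 xs ≤ b
foldr-⊔-least []       bound = z≤n
foldr-⊔-least (x ∷ xs) bound = ⊔-lub (bound zero) (foldr-⊔-least xs (bound ∘ suc))

degrees : (G : Graph) → Vec ℕ (n G)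
degrees G = map (degree G) (allFin (n G))

lookup-degrees : (G : Graph) (v : Fin (n G)) → lookup (degrees G) v ≡ degree G v
lookup-degrees G v =
  trans (lookup-map v (degree G) (allFin (n G))) (cong (degree G) (lookup-allFin v))

degree≤Δ : (G : Graph) (v : Fin (n G)) → degree G v ≤ Δ G
degree≤Δ G v = subst (_≤ Δ G) (lookup-degrees G v) (foldr-⊔-upper (degrees G) v)

Δ-least : (G : Graph) {b : ℕ} → (∀ v → degree G v ≤ b) → Δ G ≤ b
Δ-least G {b} bound =
  foldr-⊔-least (degrees G) (λ v → subst (_≤ b) (≡-sym (lookup-degrees G v)) (bound v))

-- The branch vertex φ 0 of a K_{t+1}-immersion has t distinct neighbours:
-- the first edges of the paths from φ 0 to φ 1, …, φ t are pairwise distinct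
-- because the paths are edge-disjoint.
immersion-degree : (G : Graph) → HasKImmersion G (suc t) → ∃ λ v → t ≤ degree G v
immersion-degree {t} G (φ , φ-injective , P , _ , P-disjoint) =
  φ zero , elements-≥ (adj? G (φ zero)) next next-injective (proj₁ ∘ proj₂ ∘ leave)
  where
  open Walks G
  leave : (j : Fin t) →
          ∃ λ x → Adj G (φ zero) x × (φ zero , x) ∈ edges (P zero (suc j) (s≤s z≤n))
  leave j = firstStep (P zero (suc j) (s≤s z≤n)) (0≢1+n ∘ φ-injective)
  next : Fin t → Fin (n G)
  next = proj₁ ∘ leave
  next-injective : Injective _≡_ _≡_ next
  next-injective {j} {j'} eq with j ≟ᶠ j'
  ... | yes j≡j' = j≡j'
  ... | no  j≢j' = ⊥-elim (P-disjoint zero (suc j) zero (suc j') _ _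
                             (λ (_ , sj≡sj') → j≢j' (suc-injective sj≡sj'))
                             (proj₂ (proj₂ (leave j))) (proj₂ (proj₂ (leave j')))
                             (inj₁ (refl , eq)))

immersion≤Δ+1 : (G : Graph) → HasKImmersion G t → t ≤ suc (Δ G)
immersion≤Δ+1 {zero}  G _ = z≤n
immersion≤Δ+1 {suc t} G K with immersion-degree G K
... | v , t≤deg = s≤s (≤-trans t≤deg (degree≤Δ G v))

-- The copy of G at an
-- H-vertex y is the "layer" y, the copy of H at a G-vertex x the "column" x.

module Product (G H : Graph) where

  coords : Fin (n (G □ H)) → Fin (n G) × Fin (n H)
  coords = remQuot (n H)

  ProductAdj : Fin (n G) × Fin (n H) → Fin (n G) × Fin (n H) → Set
  ProductAdj p q = (proj₁ p ≡ proj₁ q × Adj H (proj₂ p) (proj₂ q))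
                 ⊎ (Adj G (proj₁ p) (proj₁ q) × proj₂ p ≡ proj₂ q)

  coords-injective : ∀ {x y} → coords x ≡ coords y → x ≡ y
  coords-injective {x} {y} eq =
    trans (≡-sym (combine-remQuot {n G} (n H) x))
          (trans (cong (λ p → combine (proj₁ p) (proj₂ p)) eq) (combine-remQuot {n G} (n H) y))

  combine-injective : ∀ {a c : Fin (n G)} {b d : Fin (n H)} →
                      combine a b ≡ combine c d → a ≡ c × b ≡ d
  combine-injective {a} {c} {b} {d} eq =
    ,-injective (trans (≡-sym (remQuot-combine a b))
                       (trans (cong coords eq) (remQuot-combine c d)))

  adjacent-in-coords : ∀ {a b c d} → ProductAdj (a , b) (c , d) → Adj (G □ H) (combine a b) (combine c d)
  adjacent-in-coords {a} {b} {c} {d} =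
    subst₂ ProductAdj (≡-sym (remQuot-combine a b)) (≡-sym (remQuot-combine c d))

  layerWalk : ∀ {a b} (y : Fin (n H)) → Walk G a b → Walk (G □ H) (combine a y) (combine b y)
  layerWalk y []      = []
  layerWalk y (e ∷ w) = adjacent-in-coords (inj₂ (e , refl)) ∷ layerWalk y w

  columnWalk : ∀ {c d} (x : Fin (n G)) → Walk H c d → Walk (G □ H) (combine x c) (combine x d)
  columnWalk x []      = []
  columnWalk x (e ∷ w) = adjacent-in-coords (inj₁ (refl , e)) ∷ columnWalk x w

  layerEdge : Fin (n H) → Fin (n G) × Fin (n G) → Fin (n (G □ H)) × Fin (n (G □ H))
  layerEdge y (a , b) = combine a y , combine b y

  columnEdge : Fin (n G) → Fin (n H) × Fin (n H) → Fin (n (G □ H)) × Fin (n (G □ H))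
  columnEdge x (c , d) = combine x c , combine x d

  edges-layerWalk : ∀ {a b} (y : Fin (n H)) (w : Walk G a b) {e} → e ∈ edges (layerWalk y w) →
                    ∃ λ e₀ → e₀ ∈ edges w × e ≡ layerEdge y e₀
  edges-layerWalk y (_ ∷ w) (here refl) = _ , here refl , refl
  edges-layerWalk y (_ ∷ w) (there e∈) with edges-layerWalk y w e∈
  ... | e₀ , e₀∈ , eq = e₀ , there e₀∈ , eq

  edges-columnWalk : ∀ {c d} (x : Fin (n G)) (w : Walk H c d) {e} → e ∈ edges (columnWalk x w) →
                     ∃ λ e₀ → e₀ ∈ edges w × e ≡ columnEdge x e₀
  edges-columnWalk x (_ ∷ w) (here refl) = _ , here refl , refl
  edges-columnWalk x (_ ∷ w) (there e∈) with edges-columnWalk x w e∈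
  ... | e₀ , e₀∈ , eq = e₀ , there e₀∈ , eq

  same-layerEdge : ∀ y y' e e' → SameEdge (layerEdge y e) (layerEdge y' e') →
                   y ≡ y' × SameEdge e e'
  same-layerEdge y y' (a , b) (a' , b') (inj₁ (p , q)) =
    proj₂ (combine-injective p) , inj₁ (proj₁ (combine-injective p) , proj₁ (combine-injective q))
  same-layerEdge y y' (a , b) (a' , b') (inj₂ (p , q)) =
    proj₂ (combine-injective p) , inj₂ (proj₁ (combine-injective p) , proj₁ (combine-injective q))

  same-columnEdge : ∀ x x' e e' → SameEdge (columnEdge x e) (columnEdge x' e') →
                    x ≡ x' × SameEdge e e'
  same-columnEdge x x' (c , d) (c' , d') (inj₁ (p , q)) =
    proj₁ (combine-injective p) , inj₁ (proj₂ (combine-injective p) , proj₂ (combine-injective q))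
  same-columnEdge x x' (c , d) (c' , d') (inj₂ (p , q)) =
    proj₁ (combine-injective p) , inj₂ (proj₂ (combine-injective p) , proj₂ (combine-injective q))

  layerEdge≢columnEdge : ∀ y x e e' → Adj G (proj₁ e) (proj₂ e) →
                         ¬ SameEdge (layerEdge y e) (columnEdge x e')
  layerEdge≢columnEdge y x (a , b) (c , d) a~b (inj₁ (p , q)) =
    irr G (subst (Adj G a) (trans (proj₁ (combine-injective q)) (≡-sym (proj₁ (combine-injective p)))) a~b)
  layerEdge≢columnEdge y x (a , b) (c , d) a~b (inj₂ (p , q)) =
    irr G (subst (Adj G a) (trans (proj₁ (combine-injective q)) (≡-sym (proj₁ (combine-injective p)))) a~b)

  -- A neighbour of v = (g , h) is a column neighbour (g , h') with h ~ h' or a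
  -- layer neighbour (g' , h) with g ~ g'; projecting to the varying coordinate
  -- is injective on each kind, so deg(v) ≤ deg(g) + deg(h).
  degree-□ : (v : Fin (n (G □ H))) →
             degree (G □ H) v ≤ degree G (proj₁ (coords v)) + degree H (proj₂ (coords v))
  degree-□ v = begin
      degree (G □ H) v
    ≤⟨ count-⊎ column? layer? (allFin (n (G □ H))) ⟩
      count column? (allFin _) + count layer? (allFin _)
    ≤⟨ +-mono-≤ (elements-≤ column? (adj? H h) (proj₂ ∘ coords) proj₂ column-injective)
                (elements-≤ layer? (adj? G g) (proj₁ ∘ coords) proj₁ layer-injective) ⟩
      degree H h + degree G g
    ≡⟨ +-comm (degree H h) (degree G g) ⟩
      degree G g + degree H h ∎
    where
    open ≤-Reasoning
    g = proj₁ (coords v)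
    h = proj₂ (coords v)
    ColumnNeighbour LayerNeighbour : Fin (n (G □ H)) → Set
    ColumnNeighbour y = g ≡ proj₁ (coords y) × Adj H h (proj₂ (coords y))
    LayerNeighbour  y = Adj G g (proj₁ (coords y)) × h ≡ proj₂ (coords y)
    column? : Decidable ColumnNeighbour
    column? y = (g ≟ᶠ proj₁ (coords y)) ×-dec adj? H h (proj₂ (coords y))
    layer? : Decidable LayerNeighbour
    layer? y = adj? G g (proj₁ (coords y)) ×-dec (h ≟ᶠ proj₂ (coords y))
    column-injective : ∀ {y y'} → ColumnNeighbour y → ColumnNeighbour y' →
                       proj₂ (coords y) ≡ proj₂ (coords y') → y ≡ y'
    column-injective (g≡ , _) (g≡' , _) eq = coords-injective (cong₂ _,_ (trans (≡-sym g≡) g≡') eq)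
    layer-injective : ∀ {y y'} → LayerNeighbour y → LayerNeighbour y' →
                      proj₁ (coords y) ≡ proj₁ (coords y') → y ≡ y'
    layer-injective (_ , h≡) (_ , h≡') eq = coords-injective (cong₂ _,_ eq (trans (≡-sym h≡) h≡'))

Δ-□ : (G H : Graph) → Δ (G □ H) ≤ Δ G + Δ H
Δ-□ G H = Δ-least (G □ H) λ v →
  ≤-trans (Product.degree-□ G H v) (+-mono-≤ (degree≤Δ G _) (degree≤Δ H _))

-- It generalises a
-- K_t-immersion in that connections need only be walks and I need not be Fin t.
record WalkImmersion (G : Graph) (I : Set) (_≺_ : I → I → Set) : Set where
  field
    branch           : I → Fin (n G)
    branch-injective : Injective _≡_ _≡_ branch
    route            : ∀ x y → x ≺ y → Walk G (branch x) (branch y)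
    route-disjoint   : ∀ x y x' y' (h : x ≺ y) (h' : x' ≺ y') → ¬ (x ≡ x' × y ≡ y') →
                       EdgeDisjoint (route x y h) (route x' y' h')

-- Along an injective, order-preserving σ : Fin t → I a walk immersion yields a
-- K_t-immersion; each walk is shortcut to a path, which keeps disjointness.
immersion-from-walks : (G : Graph) {I : Set} {_≺_ : I → I → Set} → WalkImmersion G I _≺_ →
                       (σ : Fin t → I) → Injective _≡_ _≡_ σ →
                       (∀ {k l} → k <ᶠ l → σ k ≺ σ l) → HasKImmersion G t
immersion-from-walks G W σ σ-injective σ-monotone =
  branch ∘ σ , σ-injective ∘ branch-injective , P , P-isPath , P-disjoint
  where
  open WalkImmersion W
  open Walks G
  S : ∀ k l (k<l : k <ᶠ l) → Shortcut (route (σ k) (σ l) (σ-monotone k<l))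
  S k l k<l = shortcut (route (σ k) (σ l) (σ-monotone k<l))
  P : ∀ k l → k <ᶠ l → Walk G (branch (σ k)) (branch (σ l))
  P k l k<l = path (S k l k<l)
  P-isPath : ∀ k l (k<l : k <ᶠ l) → IsPath (P k l k<l)
  P-isPath k l k<l = path-isPath (S k l k<l)
  P-disjoint : ∀ k l k' l' (h : k <ᶠ l) (h' : k' <ᶠ l') → ¬ (k ≡ k' × l ≡ l') →
               EdgeDisjoint (P k l h) (P k' l' h')
  P-disjoint k l k' l' h h' distinct e∈ e'∈ =
    route-disjoint _ _ _ _ _ _ (λ (p , q) → distinct (σ-injective p , σ-injective q))
      (path-edges (S k l h) e∈) (path-edges (S k' l' h') e'∈)

splitAt-injective : ∀ m {k} {i j : Fin (m + k)} → splitAt m i ≡ splitAt m j → i ≡ j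
splitAt-injective m {k} {i} {j} eq =
  trans (≡-sym (join-splitAt m k i)) (trans (cong (join m k) eq) (join-splitAt m k j))

splitAt-monotone : ∀ m {k} {i j : Fin (m + k)} → i <ᶠ j →
                   (_<ᶠ_ ⊎-< _<ᶠ_) (splitAt m i) (splitAt m j)
splitAt-monotone zero    i<j = ₂∼₂ i<j
splitAt-monotone (suc m) {i = zero} {suc j} _ with splitAt m j
... | inj₁ _ = ₁∼₁ (s≤s z≤n)
... | inj₂ _ = ₁∼₂
splitAt-monotone (suc m) {i = suc i} {suc j} i<j
  with splitAt m i | splitAt m j | splitAt-monotone m (s≤s⁻¹ i<j)
... | inj₁ _ | inj₁ _ | ₁∼₁ i'<j' = ₁∼₁ (s≤s i'<j')
... | inj₁ _ | inj₂ _ | ₁∼₂       = ₁∼₂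
... | inj₂ _ | inj₂ _ | ₂∼₂ i'<j' = ₂∼₂ i'<j'

-- im(G □ H) ≥ im(G) + im(H) − 1.  Let φ, ψ be the branch maps of a
-- K_{a+1}-immersion in G and a K_{b+1}-immersion in H, with paths P_G, P_H.
-- Branch vertices: (φ i , ψ 0) for i ≤ a, and (φ 0 , ψ j) for 1 ≤ j ≤ b.
-- Connections:
--   (φ i , ψ 0) to (φ i' , ψ 0): P_G(i,i') in layer ψ 0;
--   (φ 0 , ψ j) to (φ 0 , ψ j'): P_H(j,j') in column φ 0;
--   (φ i , ψ 0) to (φ 0 , ψ j): P_H(0,j) in column φ i, then P_G(0,i)
--   backwards in layer ψ j.
-- Every edge used is tagged by the layer and G-path, or column and H-path, it
-- is copied from; equal edges have equal tags (the G- and H-paths are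
-- edge-disjoint) and distinct pairs use distinct tags.

module ProductImmersion (G H : Graph) (a b : ℕ)
                        (KG : HasKImmersion G (suc a)) (KH : HasKImmersion H (suc b)) where
  open Product G H
  open Walks (G □ H)

  φ : Fin (suc a) → Fin (n G)
  φ = proj₁ KG
  φ-injective : Injective _≡_ _≡_ φ
  φ-injective = proj₁ (proj₂ KG)
  PG : ∀ l l' → l <ᶠ l' → Walk G (φ l) (φ l')
  PG = proj₁ (proj₂ (proj₂ KG))
  PG-disjoint : ∀ l l' m m' (h : l <ᶠ l') (h' : m <ᶠ m') → ¬ (l ≡ m × l' ≡ m') →
                EdgeDisjoint (PG l l' h) (PG m m' h')
  PG-disjoint = proj₂ (proj₂ (proj₂ (proj₂ KG)))

  ψ : Fin (suc b) → Fin (n H)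
  ψ = proj₁ KH
  ψ-injective : Injective _≡_ _≡_ ψ
  ψ-injective = proj₁ (proj₂ KH)
  PH : ∀ l l' → l <ᶠ l' → Walk H (ψ l) (ψ l')
  PH = proj₁ (proj₂ (proj₂ KH))
  PH-disjoint : ∀ l l' m m' (h : l <ᶠ l') (h' : m <ᶠ m') → ¬ (l ≡ m × l' ≡ m') →
                EdgeDisjoint (PH l l' h) (PH m m' h')
  PH-disjoint = proj₂ (proj₂ (proj₂ (proj₂ KH)))

  0<suc : ∀ {r} (j : Fin r) → zero {r} <ᶠ suc j
  0<suc _ = s≤s z≤n

  -- inj₁ i stands for (φ i , ψ 0) and inj₂ j for (φ 0 , ψ (suc j)).
  Index : Set
  Index = Fin (suc a) ⊎ Fin b

  _≺_ : Index → Index → Set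
  _≺_ = _<ᶠ_ ⊎-< _<ᶠ_

  branch : Index → Fin (n (G □ H))
  branch (inj₁ i) = combine (φ i) (ψ zero)
  branch (inj₂ j) = combine (φ zero) (ψ (suc j))

  branch-injective : Injective _≡_ _≡_ branch
  branch-injective {inj₁ i} {inj₁ i'} eq = cong inj₁ (φ-injective (proj₁ (combine-injective eq)))
  branch-injective {inj₁ i} {inj₂ j}  eq = ⊥-elim (0≢1+n (ψ-injective (proj₂ (combine-injective eq))))
  branch-injective {inj₂ j} {inj₁ i}  eq =
    ⊥-elim (0≢1+n (ψ-injective (≡-sym (proj₂ (combine-injective eq)))))
  branch-injective {inj₂ j} {inj₂ j'} eq =
    cong inj₂ (suc-injective (ψ-injective (proj₂ (combine-injective eq))))

  toColumn₀ : (i : Fin (suc a)) (j : Fin (suc b)) →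
              Walk (G □ H) (combine (φ i) (ψ j)) (combine (φ zero) (ψ j))
  toColumn₀ zero    j = []
  toColumn₀ (suc i) j = reverse (layerWalk (ψ j) (PG zero (suc i) (0<suc i)))

  route : ∀ x y → x ≺ y → Walk (G □ H) (branch x) (branch y)
  route (inj₁ i) (inj₁ i') (₁∼₁ i<i') = layerWalk (ψ zero) (PG i i' i<i')
  route (inj₁ i) (inj₂ j)  ₁∼₂        =
    columnWalk (φ i) (PH zero (suc j) (0<suc j)) ++ʷ toColumn₀ i (suc j)
  route (inj₂ j) (inj₂ j') (₂∼₂ j<j') = columnWalk (φ zero) (PH (suc j) (suc j') (s≤s j<j'))

  Edge : Set
  Edge = Fin (n (G □ H)) × Fin (n (G □ H))

  -- inj₁ (y , l , l'): layer y and the path P_G(l,l');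
  -- inj₂ (x , l , l'): column x and the path P_H(l,l').
  Tag : Set
  Tag = (Fin (n H) × Fin (suc a) × Fin (suc a)) ⊎ (Fin (n G) × Fin (suc b) × Fin (suc b))

  Carries : Tag → Edge → Set
  Carries (inj₁ (y , l , l')) e =
    Σ (l <ᶠ l') λ l<l' → ∃ λ e₀ → e₀ ∈ edges (PG l l' l<l') × SameEdge e (layerEdge y e₀)
  Carries (inj₂ (x , l , l')) e =
    Σ (l <ᶠ l') λ l<l' → ∃ λ e₀ → e₀ ∈ edges (PH l l' l<l') × SameEdge e (columnEdge x e₀)

  tag-unique : ∀ τ τ' {e e'} → Carries τ e → Carries τ' e' → SameEdge e e' → τ ≡ τ'
  tag-unique (inj₁ (y , l , l')) (inj₁ (y' , m , m'))
             (h , e₀ , e₀∈ , s) (h' , e₀' , e₀'∈ , s') same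
    with same-layerEdge y y' e₀ e₀' (SameEdge-trans (SameEdge-sym s) (SameEdge-trans same s'))
  ... | refl , same₀ with (l ≟ᶠ m) ×-dec (l' ≟ᶠ m')
  ... | yes (refl , refl) = refl
  ... | no  distinct      = ⊥-elim (PG-disjoint l l' m m' h h' distinct e₀∈ e₀'∈ same₀)
  tag-unique (inj₂ (x , l , l')) (inj₂ (x' , m , m'))
             (h , e₀ , e₀∈ , s) (h' , e₀' , e₀'∈ , s') same
    with same-columnEdge x x' e₀ e₀' (SameEdge-trans (SameEdge-sym s) (SameEdge-trans same s'))
  ... | refl , same₀ with (l ≟ᶠ m) ×-dec (l' ≟ᶠ m')
  ... | yes (refl , refl) = refl
  ... | no  distinct      = ⊥-elim (PH-disjoint l l' m m' h h' distinct e₀∈ e₀'∈ same₀)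
  tag-unique (inj₁ (y , l , l')) (inj₂ (x , m , m')) (h , e₀ , e₀∈ , s) (_ , e₀' , _ , s') same =
    ⊥-elim (layerEdge≢columnEdge y x e₀ e₀' (Walks.edge-adjacent G (PG l l' h) e₀∈)
              (SameEdge-trans (SameEdge-sym s) (SameEdge-trans same s')))
  tag-unique (inj₂ (x , m , m')) (inj₁ (y , l , l')) (_ , e₀' , _ , s') (h , e₀ , e₀∈ , s) same =
    ⊥-elim (layerEdge≢columnEdge y x e₀ e₀' (Walks.edge-adjacent G (PG l l' h) e₀∈)
              (SameEdge-trans (SameEdge-sym s) (SameEdge-trans (SameEdge-sym same) s')))

  Uses : ∀ {x y} → x ≺ y → Tag → Set
  Uses {inj₁ i} {inj₁ i'} (₁∼₁ _) τ = τ ≡ inj₁ (ψ zero , i , i')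
  Uses {inj₁ i} {inj₂ j}  ₁∼₂     τ =
    τ ≡ inj₂ (φ i , zero , suc j) ⊎ τ ≡ inj₁ (ψ (suc j) , zero , i)
  Uses {inj₂ j} {inj₂ j'} (₂∼₂ _) τ = τ ≡ inj₂ (φ zero , suc j , suc j')

  layerTag-injective : ∀ {y y' l l' m m'} → (Tag ∋ inj₁ (y , l , l')) ≡ inj₁ (y' , m , m') →
                       y ≡ y' × l ≡ m × l' ≡ m'
  layerTag-injective refl = refl , refl , refl

  columnTag-injective : ∀ {x x' l l' m m'} → (Tag ∋ inj₂ (x , l , l')) ≡ inj₂ (x' , m , m') →
                        x ≡ x' × l ≡ m × l' ≡ m'
  columnTag-injective refl = refl , refl , refl

  uses-determine : ∀ {x y x' y'} (h : x ≺ y) (h' : x' ≺ y') {τ} → Uses h τ → Uses h' τ →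
                   x ≡ x' × y ≡ y'
  uses-determine (₁∼₁ _) (₁∼₁ _) refl eq with layerTag-injective eq
  ... | _ , i≡ , i'≡ = cong inj₁ i≡ , cong inj₁ i'≡
  uses-determine (₁∼₁ _) ₁∼₂ refl (inj₁ ())
  uses-determine (₁∼₁ _) ₁∼₂ refl (inj₂ eq) =
    ⊥-elim (0≢1+n (ψ-injective (proj₁ (layerTag-injective eq))))
  uses-determine (₁∼₁ _) (₂∼₂ _) refl ()
  uses-determine ₁∼₂ (₁∼₁ _) (inj₁ refl) ()
  uses-determine ₁∼₂ (₁∼₁ _) (inj₂ refl) eq =
    ⊥-elim (0≢1+n (ψ-injective (≡-sym (proj₁ (layerTag-injective eq)))))
  uses-determine ₁∼₂ ₁∼₂ (inj₁ refl) (inj₁ eq) with columnTag-injective eq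
  ... | φi≡ , _ , j≡ = cong inj₁ (φ-injective φi≡) , cong inj₂ (suc-injective j≡)
  uses-determine ₁∼₂ ₁∼₂ (inj₁ refl) (inj₂ ())
  uses-determine ₁∼₂ ₁∼₂ (inj₂ refl) (inj₁ ())
  uses-determine ₁∼₂ ₁∼₂ (inj₂ refl) (inj₂ eq) with layerTag-injective eq
  ... | ψj≡ , _ , i≡ = cong inj₁ i≡ , cong inj₂ (suc-injective (ψ-injective ψj≡))
  uses-determine ₁∼₂ (₂∼₂ _) (inj₁ refl) eq =
    ⊥-elim (0≢1+n (proj₁ (proj₂ (columnTag-injective eq))))
  uses-determine ₁∼₂ (₂∼₂ _) (inj₂ refl) ()
  uses-determine (₂∼₂ _) (₁∼₁ _) refl ()
  uses-determine (₂∼₂ _) ₁∼₂ refl (inj₁ eq) =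
    ⊥-elim (0≢1+n (≡-sym (proj₁ (proj₂ (columnTag-injective eq)))))
  uses-determine (₂∼₂ _) ₁∼₂ refl (inj₂ ())
  uses-determine (₂∼₂ _) (₂∼₂ _) refl eq with columnTag-injective eq
  ... | _ , j≡ , j'≡ = cong inj₂ (suc-injective j≡) , cong inj₂ (suc-injective j'≡)

  ≡⇒SameEdge : ∀ {e e' : Edge} → e ≡ e' → SameEdge e e'
  ≡⇒SameEdge {e} refl = SameEdge-refl e

  swap≡⇒SameEdge : ∀ {e e' : Edge} → swap e ≡ e' → SameEdge e e'
  swap≡⇒SameEdge {e} refl = SameEdge-swap e

  route-tags : ∀ x y (h : x ≺ y) {e} → e ∈ edges (route x y h) → ∃ λ τ → Uses h τ × Carries τ e
  route-tags (inj₁ i) (inj₁ i') (₁∼₁ i<i') e∈ with edges-layerWalk (ψ zero) (PG i i' i<i') e∈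
  ... | e₀ , e₀∈ , eq = _ , refl , i<i' , e₀ , e₀∈ , ≡⇒SameEdge eq
  route-tags (inj₁ i) (inj₂ j) ₁∼₂ e∈ with edges-++ (columnWalk (φ i) _) (toColumn₀ i (suc j)) e∈
  ... | inj₁ e∈column with edges-columnWalk (φ i) (PH zero (suc j) (0<suc j)) e∈column
  ...   | e₀ , e₀∈ , eq = _ , inj₁ refl , 0<suc j , e₀ , e₀∈ , ≡⇒SameEdge eq
  route-tags (inj₁ (suc i)) (inj₂ j) ₁∼₂ e∈ | inj₂ e∈layer
    with edges-layerWalk (ψ (suc j)) (PG zero (suc i) (0<suc i)) (edges-reverse _ e∈layer)
  ... | e₀ , e₀∈ , eq = _ , inj₂ refl , 0<suc i , e₀ , e₀∈ , swap≡⇒SameEdge eq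
  route-tags (inj₂ j) (inj₂ j') (₂∼₂ j<j') e∈
    with edges-columnWalk (φ zero) (PH (suc j) (suc j') (s≤s j<j')) e∈
  ... | e₀ , e₀∈ , eq = _ , refl , s≤s j<j' , e₀ , e₀∈ , ≡⇒SameEdge eq

  walkImmersion : WalkImmersion (G □ H) Index _≺_
  walkImmersion = record
    { branch           = branch
    ; branch-injective = branch-injective
    ; route            = route
    ; route-disjoint   = disjoint
    }
    where
    disjoint : ∀ x y x' y' (h : x ≺ y) (h' : x' ≺ y') → ¬ (x ≡ x' × y ≡ y') →
               EdgeDisjoint (route x y h) (route x' y' h')
    disjoint x y x' y' h h' distinct e∈ e'∈ same
      with route-tags x y h e∈ | route-tags x' y' h' e'∈
    ... | τ , uses , carries | τ' , uses' , carries'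
      with tag-unique τ τ' carries carries' same
    ... | refl = distinct (uses-determine h h' uses uses')

immersion-□ : (G H : Graph) {a b : ℕ} → HasKImmersion G (suc a) → HasKImmersion H (suc b) →
              HasKImmersion (G □ H) (suc (a + b))
immersion-□ G H {a} {b} KG KH =
  immersion-from-walks (G □ H) (ProductImmersion.walkImmersion G H a b KG KH)
    (splitAt (suc a)) (splitAt-injective (suc a)) (splitAt-monotone (suc a))

immersion-□-all : ∀ {ℓ} (Gs : Vec Graph (suc ℓ)) (ks : Vec ℕ (suc ℓ)) →
                  (∀ i → HasKImmersion (lookup Gs i) (suc (lookup ks i))) →
                  HasKImmersion (□-all Gs) (suc (sum ks))
immersion-□-all (G ∷ [])     (k ∷ [])  K =
  subst (HasKImmersion G ∘ suc) (≡-sym (+-identityʳ k)) (K zero)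
immersion-□-all (G ∷ H ∷ Gs) (k ∷ ks) K =
  immersion-□ G (□-all (H ∷ Gs)) (K zero) (immersion-□-all (H ∷ Gs) ks (K ∘ suc))

Δ-□-all : ∀ {ℓ} (Gs : Vec Graph (suc ℓ)) (ks : Vec ℕ (suc ℓ)) →
          (∀ i → Δ (lookup Gs i) ≤ lookup ks i) → Δ (□-all Gs) ≤ sum ks
Δ-□-all (G ∷ [])     (k ∷ [])  bound = ≤-trans (bound zero) (m≤m+n k 0)
Δ-□-all (G ∷ H ∷ Gs) (k ∷ ks) bound =
  ≤-trans (Δ-□ G (□-all (H ∷ Gs))) (+-mono-≤ (bound zero) (Δ-□-all (H ∷ Gs) ks (bound ∘ suc)))

-- Every graph with a vertex has a K₁-immersion, so immersion numbers are positive.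
K₁-immersion : (G : Graph) → 1 ≤ n G → HasKImmersion G 1
K₁-immersion G 1≤n =
  (λ _ → fromℕ< 1≤n) , single-injective , (λ { zero zero () }) , (λ { zero zero () }) ,
  (λ { zero zero _ _ () })
  where
  single-injective : Injective _≡_ _≡_ (λ (_ : Fin 1) → fromℕ< 1≤n)
  single-injective {zero} {zero} _ = refl

suc-∸1 : ∀ {x} → 1 ≤ x → suc (x ∸ 1) ≡ x
suc-∸1 {x} 1≤x = trans (+-comm 1 (x ∸ 1)) (m∸n+n≡m 1≤x)

sum-∸1+length : (xs : Vec ℕ k) → (∀ i → 1 ≤ lookup xs i) → sum (map (_∸ 1) xs) + k ≡ sum xs
sum-∸1+length []       _        = refl
sum-∸1+length {suc k} (x ∷ xs) positive = begin
    (x ∸ 1 + S) + suc k   ≡⟨ +-suc (x ∸ 1 + S) k ⟩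
    suc ((x ∸ 1 + S) + k) ≡⟨ cong suc (+-assoc (x ∸ 1) S k) ⟩
    suc (x ∸ 1 + (S + k)) ≡⟨ cong (λ s → suc (x ∸ 1 + s)) (sum-∸1+length xs (positive ∘ suc)) ⟩
    suc (x ∸ 1) + sum xs  ≡⟨ cong (_+ sum xs) (suc-∸1 (positive zero)) ⟩
    x + sum xs            ∎
  where
  open ≡-Reasoning
  S = sum (map (_∸ 1) xs)

suc-sum-∸1 : ∀ {ℓ} (xs : Vec ℕ (suc ℓ)) → (∀ i → 1 ≤ lookup xs i) →
             suc (sum (map (_∸ 1) xs)) ≡ sum xs ∸ ℓ
suc-sum-∸1 {ℓ} xs positive = begin
    suc S                   ≡⟨ m+n∸n≡m (suc S) ℓ ⟨
    (suc S + ℓ) ∸ ℓ         ≡⟨ cong (_∸ ℓ) (+-suc S ℓ) ⟨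
    (S + suc ℓ) ∸ ℓ         ≡⟨ cong (_∸ ℓ) (sum-∸1+length xs positive) ⟩
    sum xs ∸ ℓ              ∎
  where
  open ≡-Reasoning
  S = sum (map (_∸ 1) xs)

corollary14 : (ℓ : ℕ) (Gs : Vec Graph (suc ℓ)) (ims : Vec ℕ (suc ℓ)) (p : ℕ) →
  (∀ i → 1 ≤ n (lookup Gs i)) →
  (∀ i → IsImmersionNumber (lookup Gs i) (lookup ims i)) →
  IsImmersionNumber (□-all Gs) p →
  (sum ims ∸ ℓ ≤ p) ×
  ((∀ i → Δ (lookup Gs i) ≡ lookup ims i ∸ 1) → p ≡ sum ims ∸ ℓ)
corollary14 ℓ Gs ims p nonempty im-Gs im-□ = lower , upper
  where
  ks : Vec ℕ (suc ℓ)
  ks = map (_∸ 1) ims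
  positive : ∀ i → 1 ≤ lookup ims i
  positive i = proj₂ (im-Gs i) 1 (K₁-immersion (lookup Gs i) (nonempty i))
  lookup-ks : ∀ i → lookup ks i ≡ lookup ims i ∸ 1
  lookup-ks i = lookup-map i (_∸ 1) ims
  K-Gs : ∀ i → HasKImmersion (lookup Gs i) (suc (lookup ks i))
  K-Gs i = subst (HasKImmersion (lookup Gs i))
                 (≡-sym (trans (cong suc (lookup-ks i)) (suc-∸1 (positive i)))) (proj₁ (im-Gs i))
  lower : sum ims ∸ ℓ ≤ p
  lower = proj₂ im-□ _ (subst (HasKImmersion (□-all Gs)) (suc-sum-∸1 ims positive)
                              (immersion-□-all Gs ks K-Gs))
  upper : (∀ i → Δ (lookup Gs i) ≡ lookup ims i ∸ 1) → p ≡ sum ims ∸ ℓ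
  upper Δ≡ = ≤-antisym (begin
      p                     ≤⟨ immersion≤Δ+1 (□-all Gs) (proj₁ im-□) ⟩
      suc (Δ (□-all Gs))    ≤⟨ s≤s (Δ-□-all Gs ks Δ-bound) ⟩
      suc (sum ks)          ≡⟨ suc-sum-∸1 ims positive ⟩
      sum ims ∸ ℓ           ∎) lower
    where
    open ≤-Reasoning
    Δ-bound : ∀ i → Δ (lookup Gs i) ≤ lookup ks i
    Δ-bound i = ≤-reflexive (trans (Δ≡ i) (≡-sym (lookup-ks i)))
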